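{- Let $p$ be an odd prime and $k,n$ positive integers. If either $k\equiv n\equiv 0\pmod{p-1}$ or $k\equiv n\equiv 1\pmod{p-1}$, then \[ B^{(-k)}_{n}\equiv 2\pmod{p}. \]
   Context: For any integer $k$, let $\mathrm{Li}_k(t)=\sum_{n\geq 1} t^n/n^k$ (for $k\le 0$ this is a rational function of $t$). The poly-Bernoulli numbers $B^{(k)}_n$ ($n\geq 0$) are defined by \[ \frac{\mathrm{Li}_{k}(1-e^{ -t})}{1-e^{ -t}}=\sum_{n=0}^{\infty}B^{(k)}_{n}\frac{t^n}{n!}. \] For negative upper index these are positive integers. -}

module Defs where

open import Data.Nat as ℕ using (ℕ; zero; suc; _!)
open import Data.Nat.Properties using (_!≢0)
open import Data.Integer as ℤ using (ℤ)
open import Data.Rational as ℚ using (ℚ; 0ℚ; 1ℚ; _+_; _*_; -_)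
open import Data.List using (List; []; _∷_; map; upTo)

sumℚ : List ℚ → ℚ
sumℚ []       = 0ℚ
sumℚ (x ∷ xs) = x + sumℚ xs

-- Formal power series over ℚ in the variable t, represented by coefficient
-- functions: (f i) is the coefficient of t^i.
Series : Set
Series = ℕ → ℚ

const : ℚ → Series
const c zero    = c
const c (suc _) = 0ℚ

_⊛_ : Series → Series → Series
(f ⊛ g) i = sumℚ (map (λ j → f j * g (i ℕ.∸ j)) (upTo (suc i)))

_^ˢ_ : Series → ℕ → Series
f ^ˢ zero  = const 1ℚ
f ^ˢ suc m = f ⊛ (f ^ˢ m)

fromℕℚ : ℕ → ℚ
fromℕℚ n = (ℤ.+ n) ℚ./ 1

sgn : ℕ → ℤ
sgn zero    = ℤ.+ 1
sgn (suc j) = ℤ.- sgn j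

expNeg : Series
expNeg i = (sgn i ℚ./ (i !)) {{i !≢0}}

oneMinusExpNeg : Series
oneMinusExpNeg i = const 1ℚ i + (- expNeg i)

-- For k ≥ 0, Li_{-k}(x)/x = Σ_{m ≥ 1} m^k x^{m-1} (as a power series in x).
-- Substituting x = 1 - e^{-t} (which has zero constant term), only the
-- terms with m - 1 ≤ n contribute to the coefficient of t^n, so the
-- coefficient of t^n of Li_{-k}(1-e^{-t})/(1-e^{-t}) is exactly the
-- following finite sum (j = m - 1 ranges over 0..n).
LiQuotCoeff : ℕ → ℕ → ℚ
LiQuotCoeff k n =
  sumℚ (map (λ j → fromℕℚ (suc j ℕ.^ k) * (oneMinusExpNeg ^ˢ j) n) (upTo (suc n)))

polyBernoulliNeg : ℕ → ℕ → ℚ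
polyBernoulliNeg k n = fromℕℚ (n !) * LiQuotCoeff k n

module Submission where

open import Defs
open import Data.Nat using (ℕ; _∸_; _≥_)
open import Data.Nat.Primality using (Prime)
open import Data.Nat.Divisibility as ℕᵈ using ()
open import Data.Integer as ℤ using (ℤ; _-_)
open import Data.Integer.Divisibility using (_∣_)
open import Data.Rational using (_/_)
open import Data.Product using (_×_; ∃-syntax)
open import Data.Sum using (_⊎_)
open import Relation.Binary.PropositionalEquality using (_≡_; _≢_)

open import Algebra.Bundles using (CommutativeRing)
open import Data.Nat using (zero; suc; pred; _<_; _≤_; s≤s; z≤n; _!)
import Data.Nat as ℕ
open import Function using (_∘_; id)

-- Write x = 1 - e^{-t}. Then B_n^{(-k)} = Σ_{j ≤ n} (j+1)^k c_j(n), where c_j(n) = n! [tⁿ] x^j.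
-- Since x' = 1 - x, the Leibniz rule gives c_j(n+1) = j (c_{j-1}(n) - c_j(n)); hence c_j(n) is an
-- integer divisible by j!, vanishing for j > n, and equal to Σ_i (j choose i) (-1)^i (-i)^n, the
-- coefficient sequence of Σ_i (j choose i) (-1)^i e^{-it}.
-- Modulo p the terms with j ≥ p drop out, and for j < p Fermat's little theorem shows that
-- (j+1)^k and c_j(n) only depend on k and n modulo p - 1 (for k, n ≥ 1). If k ≡ n ≡ 1 the sum is
-- therefore congruent to B_1^{(-1)} = 2. If k ≡ n ≡ 0, then (j+1)^k ≡ 1 for j + 1 < p and ≡ 0 for
-- j + 1 = p, while c_j(n) ≡ Σ_{i ≥ 1} (j choose i) (-1)^i = δ_{j0} - 1, so the sum is 1 - (p - 1) ≡ 2.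

-- ∑ depends only on _+_ and 0#, so that ℤ and the ring ℤmod p below, which share carrier and
-- operations, have definitionally the same sums.
module Sum {a} {A : Set a} (_+_ : A → A → A) (0# : A) where

  ∑ : ℕ → (ℕ → A) → A
  ∑ zero    f = 0#
  ∑ (suc n) f = f 0 + ∑ n (f ∘ suc)

  syntax ∑ n (λ i → t) = ∑[ i < n ] t

module FiniteSum {c ℓ} (R : CommutativeRing c ℓ) where

  open CommutativeRing R hiding (_-_)
  open import Algebra.Properties.Ring ring using (-1*x≈-x)
  open import Algebra.Properties.CommutativeSemigroup +-commutativeSemigroup using (interchange)
  open import Relation.Binary.Reasoning.Setoid setoid
  open Sum _+_ 0# public

  ∑-cong : ∀ n {f g : ℕ → Carrier} → (∀ i → i < n → f i ≈ g i) → ∑ n f ≈ ∑ n g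
  ∑-cong zero    f≈g = refl
  ∑-cong (suc n) f≈g = +-cong (f≈g 0 (s≤s z≤n)) (∑-cong n (λ i i<n → f≈g (suc i) (s≤s i<n)))

  ∑-vanishes : ∀ n {f : ℕ → Carrier} → (∀ i → i < n → f i ≈ 0#) → ∑ n f ≈ 0#
  ∑-vanishes zero    f≈0 = refl
  ∑-vanishes (suc n) f≈0 =
    trans (+-cong (f≈0 0 (s≤s z≤n)) (∑-vanishes n (λ i i<n → f≈0 (suc i) (s≤s i<n)))) (+-identityˡ 0#)

  ∑-distrib-+ : ∀ n (f g : ℕ → Carrier) → ∑[ i < n ] (f i + g i) ≈ ∑ n f + ∑ n g
  ∑-distrib-+ zero    f g = sym (+-identityˡ 0#)
  ∑-distrib-+ (suc n) f g = begin
    (f 0 + g 0) + ∑[ i < n ] (f (suc i) + g (suc i))  ≈⟨ +-congˡ (∑-distrib-+ n (f ∘ suc) (g ∘ suc)) ⟩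
    (f 0 + g 0) + (∑ n (f ∘ suc) + ∑ n (g ∘ suc))     ≈⟨ interchange (f 0) (g 0) _ _ ⟩
    (f 0 + ∑ n (f ∘ suc)) + (g 0 + ∑ n (g ∘ suc))     ∎

  *-distribˡ-∑ : ∀ n x (f : ℕ → Carrier) → x * ∑ n f ≈ ∑[ i < n ] (x * f i)
  *-distribˡ-∑ zero    x f = zeroʳ x
  *-distribˡ-∑ (suc n) x f = trans (distribˡ x (f 0) _) (+-congˡ (*-distribˡ-∑ n x (f ∘ suc)))

  -‿∑ : ∀ n (f : ℕ → Carrier) → - ∑ n f ≈ ∑[ i < n ] (- f i)
  -‿∑ n f = begin
    - ∑ n f                  ≈⟨ -1*x≈-x _ ⟨
    - 1# * ∑ n f             ≈⟨ *-distribˡ-∑ n (- 1#) f ⟩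
    ∑[ i < n ] (- 1# * f i)  ≈⟨ ∑-cong n (λ i _ → -1*x≈-x (f i)) ⟩
    ∑[ i < n ] (- f i)       ∎

  ∑-distrib-- : ∀ n (f g : ℕ → Carrier) → ∑[ i < n ] (f i + - g i) ≈ ∑ n f + - ∑ n g
  ∑-distrib-- n f g = trans (∑-distrib-+ n f (-_ ∘ g)) (+-congˡ (sym (-‿∑ n g)))

  ∑-init-last : ∀ n (f : ℕ → Carrier) → ∑ (suc n) f ≈ ∑ n f + f n
  ∑-init-last zero    f = trans (+-identityʳ (f 0)) (sym (+-identityˡ (f 0)))
  ∑-init-last (suc n) f = begin
    f 0 + ∑ (suc n) (f ∘ suc)          ≈⟨ +-congˡ (∑-init-last n (f ∘ suc)) ⟩
    f 0 + (∑ n (f ∘ suc) + f (suc n))  ≈⟨ +-assoc _ _ _ ⟨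
    ∑ (suc n) f + f (suc n)            ∎

  ∑-split : ∀ m n (f : ℕ → Carrier) → ∑ (m ℕ.+ n) f ≈ ∑ m f + ∑[ i < n ] f (m ℕ.+ i)
  ∑-split zero    n f = sym (+-identityˡ _)
  ∑-split (suc m) n f = trans (+-congˡ (∑-split m n (f ∘ suc))) (sym (+-assoc _ _ _))

  ∑-extend : ∀ m n (f : ℕ → Carrier) → (∀ i → i < n → f (m ℕ.+ i) ≈ 0#) → ∑ (m ℕ.+ n) f ≈ ∑ m f
  ∑-extend m n f tail≈0 = begin
    ∑ (m ℕ.+ n) f                   ≈⟨ ∑-split m n f ⟩
    ∑ m f + ∑[ i < n ] f (m ℕ.+ i)  ≈⟨ +-congˡ (∑-vanishes n tail≈0) ⟩
    ∑ m f + 0#                      ≈⟨ +-identityʳ _ ⟩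
    ∑ m f                           ∎

open import Level using (0ℓ)
import Data.Nat.Properties as ℕ
open import Data.Nat.Properties using (_!≢0; _!*_!≢0)
open import Data.Nat.Combinatorics
  using (_C_; nCk≡n!/k![n-k]!; k![n∸k]!∣n!; nCk+nC[k+1]≡[n+1]C[k+1]; k>n⇒nCk≡0; nCn≡1)
open import Data.Nat.DivMod using (m/n*n≡m)
open import Data.Nat.Primality using (euclidsLemma; ¬prime[0]; ¬prime[1])
import Data.Nat.Tactic.RingSolver as ℕ-Solver
open import Data.Integer using (+_; -[1+_]; 0ℤ; 1ℤ; -1ℤ; _+_; _*_; -_; _^_)
import Data.Integer.Properties as ℤ
import Data.Integer.Divisibility.Signed as Div
open import Data.Integer.Tactic.RingSolver using (solve-∀)
open import Data.Rational as ℚ using (ℚ; 0ℚ; 1ℚ; toℚᵘ)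
import Data.Rational.Properties as ℚ
open import Data.Rational.Unnormalised as ℚᵘ using (mkℚᵘ; *≡*)
import Data.Rational.Unnormalised.Properties as ℚᵘ
open import Data.Rational.Solver using (module +-*-Solver)
open import Data.List using (map; applyUpTo; upTo)
open import Data.Product using (_,_)
open import Data.Sum using (inj₁; inj₂)
open import Relation.Nullary using (¬_; yes; no; contradiction)
open import Relation.Binary.PropositionalEquality
  using (refl; sym; trans; cong; cong₂; subst; subst₂; module ≡-Reasoning)

open FiniteSum ℤ.+-*-commutativeRing
module ℚ∑ = FiniteSum ℚ.+-*-commutativeRing

nCk*k!*[n∸k]!≡n! : ∀ {n k} → k ≤ n → (n C k) ℕ.* (k ! ℕ.* (n ∸ k) !) ≡ n !
nCk*k!*[n∸k]!≡n! {n} {k} k≤n = trans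
  (cong (ℕ._* (k ! ℕ.* (n ∸ k) !)) (nCk≡n!/k![n-k]! k≤n))
  (m/n*n≡m {{k !* (n ∸ k) !≢0}} (k![n∸k]!∣n! k≤n))

[1+n]C[1+k]*[1+k]≡[1+n]*nCk : ∀ n k → (suc n C suc k) ℕ.* suc k ≡ suc n ℕ.* (n C k)
[1+n]C[1+k]*[1+k]≡[1+n]*nCk n k with k ℕ.≤? n
... | no k≰n = begin
  (suc n C suc k) ℕ.* suc k  ≡⟨ cong (ℕ._* suc k) (k>n⇒nCk≡0 (s≤s (ℕ.≰⇒> k≰n))) ⟩
  0                          ≡⟨ ℕ.*-zeroʳ (suc n) ⟨
  suc n ℕ.* 0                ≡⟨ cong (suc n ℕ.*_) (k>n⇒nCk≡0 (ℕ.≰⇒> k≰n)) ⟨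
  suc n ℕ.* (n C k)          ∎
  where open ≡-Reasoning
... | yes k≤n = ℕ.*-cancelʳ-≡ _ _ (k ! ℕ.* (n ∸ k) !) {{k !* (n ∸ k) !≢0}} (begin
  (suc n C suc k) ℕ.* suc k ℕ.* (k ! ℕ.* (n ∸ k) !)  ≡⟨ rearrange (suc n C suc k) (suc k) (k !) ((n ∸ k) !) ⟩
  (suc n C suc k) ℕ.* (suc k ! ℕ.* (n ∸ k) !)        ≡⟨ nCk*k!*[n∸k]!≡n! (s≤s k≤n) ⟩
  suc n !                                            ≡⟨ cong (suc n ℕ.*_) (nCk*k!*[n∸k]!≡n! k≤n) ⟨
  suc n ℕ.* ((n C k) ℕ.* (k ! ℕ.* (n ∸ k) !))        ≡⟨ ℕ.*-assoc (suc n) (n C k) _ ⟨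
  suc n ℕ.* (n C k) ℕ.* (k ! ℕ.* (n ∸ k) !)          ∎)
  where
  open ≡-Reasoning
  rearrange : ∀ c s f g → c ℕ.* s ℕ.* (f ℕ.* g) ≡ c ℕ.* (s ℕ.* f ℕ.* g)
  rearrange = ℕ-Solver.solve-∀

p∣pCk : ∀ {p k} → Prime p → 0 < k → k < p → p ℕᵈ.∣ p C k
p∣pCk {suc p-1} {suc k-1} p-prime _ k<p
  with euclidsLemma (suc p-1 C suc k-1) (suc k-1) p-prime
         (subst (suc p-1 ℕᵈ.∣_) (sym ([1+n]C[1+k]*[1+k]≡[1+n]*nCk p-1 k-1)) (ℕᵈ.m∣m*n (p-1 C k-1)))
... | inj₁ p∣pCk = p∣pCk
... | inj₂ p∣k   = contradiction (ℕᵈ.∣⇒≤ p∣k) (ℕ.<⇒≱ k<p)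

infixl 7 _⋆_
_⋆_ : (ℕ → ℤ) → (ℕ → ℤ) → ℕ → ℤ
(a ⋆ b) n = ∑[ m < suc n ] (+ (n C m) * a m * b (n ∸ m))

δ : ℕ → ℤ
δ zero    = + 1
δ (suc _) = + 0

⋆-identityˡ : ∀ a n → (δ ⋆ a) n ≡ a n
⋆-identityˡ a n = begin
  + 1 * + 1 * a n + ∑[ m < n ] (+ (n C suc m) * + 0 * a (n ∸ suc m))
    ≡⟨ cong (λ s → + 1 * + 1 * a n + s) (∑-vanishes n (λ m _ → vanish (+ (n C suc m)) (a (n ∸ suc m)))) ⟩
  + 1 * + 1 * a n + + 0
    ≡⟨ unit (a n) ⟩
  a n ∎
  where
  open ≡-Reasoning
  vanish : ∀ c x → c * + 0 * x ≡ + 0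
  vanish = solve-∀
  unit : ∀ x → + 1 * + 1 * x + + 0 ≡ x
  unit = solve-∀

⋆-congˡ : ∀ {a a′} b n → (∀ m → a m ≡ a′ m) → (a ⋆ b) n ≡ (a′ ⋆ b) n
⋆-congˡ b n a≗a′ = ∑-cong (suc n) (λ m _ → cong (λ t → + (n C m) * t * b (n ∸ m)) (a≗a′ m))

⋆-congʳ : ∀ a {b b′} n → (∀ m → b m ≡ b′ m) → (a ⋆ b) n ≡ (a ⋆ b′) n
⋆-congʳ a n b≗b′ = ∑-cong (suc n) (λ m _ → cong (λ t → + (n C m) * a m * t) (b≗b′ (n ∸ m)))

⋆-scaleˡ : ∀ x a b n → ((λ m → x * a m) ⋆ b) n ≡ x * (a ⋆ b) n
⋆-scaleˡ x a b n = trans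
  (∑-cong (suc n) (λ m _ → pull (+ (n C m)) x (a m) (b (n ∸ m))))
  (sym (*-distribˡ-∑ (suc n) x (λ m → + (n C m) * a m * b (n ∸ m))))
  where
  pull : ∀ c x u v → c * (x * u) * v ≡ x * (c * u * v)
  pull = solve-∀

⋆-scaleʳ : ∀ x a b n → (a ⋆ (λ m → x * b m)) n ≡ x * (a ⋆ b) n
⋆-scaleʳ x a b n = trans
  (∑-cong (suc n) (λ m _ → pull (+ (n C m)) x (a m) (b (n ∸ m))))
  (sym (*-distribˡ-∑ (suc n) x (λ m → + (n C m) * a m * b (n ∸ m))))
  where
  pull : ∀ c x u v → c * u * (x * v) ≡ x * (c * u * v)
  pull = solve-∀

⋆-subˡ : ∀ a a′ b n → ((λ m → a m - a′ m) ⋆ b) n ≡ (a ⋆ b) n - (a′ ⋆ b) n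
⋆-subˡ a a′ b n = trans
  (∑-cong (suc n) (λ m _ → expand (+ (n C m)) (a m) (a′ m) (b (n ∸ m))))
  (∑-distrib-- (suc n) (λ m → + (n C m) * a m * b (n ∸ m)) (λ m → + (n C m) * a′ m * b (n ∸ m)))
  where
  expand : ∀ c u u′ v → c * (u - u′) * v ≡ c * u * v - c * u′ * v
  expand = solve-∀

⋆-subʳ : ∀ a b b′ n → (a ⋆ (λ m → b m - b′ m)) n ≡ (a ⋆ b) n - (a ⋆ b′) n
⋆-subʳ a b b′ n = trans
  (∑-cong (suc n) (λ m _ → expand (+ (n C m)) (a m) (b (n ∸ m)) (b′ (n ∸ m))))
  (∑-distrib-- (suc n) (λ m → + (n C m) * a m * b (n ∸ m)) (λ m → + (n C m) * a m * b′ (n ∸ m)))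
  where
  expand : ∀ c u v v′ → c * u * (v - v′) ≡ c * u * v - c * u * v′
  expand = solve-∀

⋆-leibniz : ∀ a b n → (a ⋆ b) (suc n) ≡ ((a ∘ suc) ⋆ b) n + (a ⋆ (b ∘ suc)) n
⋆-leibniz a b n = begin
  a₀ + ∑[ m < suc n ] (+ (suc n C suc m) * a (suc m) * b (n ∸ m))
    ≡⟨ cong (_+_ a₀) (∑-cong (suc n) (λ m _ → pascal m)) ⟩
  a₀ + ∑[ m < suc n ] (f m + g m)
    ≡⟨ cong (_+_ a₀) (∑-distrib-+ (suc n) f g) ⟩
  a₀ + (((a ∘ suc) ⋆ b) n + ∑ (suc n) g)
    ≡⟨ cong (λ s → a₀ + (((a ∘ suc) ⋆ b) n + s)) (∑-init-last n g) ⟩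
  a₀ + (((a ∘ suc) ⋆ b) n + (∑ n g + g n))
    ≡⟨ cong (λ t → a₀ + (((a ∘ suc) ⋆ b) n + (∑ n g + t))) g[n]≡0 ⟩
  a₀ + (((a ∘ suc) ⋆ b) n + (∑ n g + + 0))
    ≡⟨ regroup a₀ (((a ∘ suc) ⋆ b) n) (∑ n g) ⟩
  ((a ∘ suc) ⋆ b) n + (a₀ + ∑ n g)
    ≡⟨ cong (λ s → ((a ∘ suc) ⋆ b) n + (a₀ + s)) (∑-cong n (λ m m<n →
         cong (λ k → + (n C suc m) * a (suc m) * b k) (ℕ.+-∸-assoc 1 m<n))) ⟩
  ((a ∘ suc) ⋆ b) n + (a ⋆ (b ∘ suc)) n ∎
  where
  open ≡-Reasoning
  a₀ = + 1 * a 0 * b (suc n)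
  f g : ℕ → ℤ
  f m = + (n C m) * a (suc m) * b (n ∸ m)
  g m = + (n C suc m) * a (suc m) * b (n ∸ m)
  distrib : ∀ c c′ u v → (c + c′) * u * v ≡ c * u * v + c′ * u * v
  distrib = solve-∀
  pascal : ∀ m → + (suc n C suc m) * a (suc m) * b (n ∸ m) ≡ f m + g m
  pascal m = begin
    + (suc n C suc m) * a (suc m) * b (n ∸ m)
      ≡⟨ cong (λ c → + c * a (suc m) * b (n ∸ m)) (nCk+nC[k+1]≡[n+1]C[k+1] n m) ⟨
    + (n C m ℕ.+ n C suc m) * a (suc m) * b (n ∸ m)
      ≡⟨ cong (λ c → c * a (suc m) * b (n ∸ m)) (ℤ.pos-+ (n C m) (n C suc m)) ⟩
    (+ (n C m) + + (n C suc m)) * a (suc m) * b (n ∸ m)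
      ≡⟨ distrib (+ (n C m)) (+ (n C suc m)) (a (suc m)) (b (n ∸ m)) ⟩
    f m + g m ∎
  g[n]≡0 : g n ≡ + 0
  g[n]≡0 = cong (λ c → + c * a (suc n) * b (n ∸ n)) (k>n⇒nCk≡0 (ℕ.n<1+n n))
  regroup : ∀ x y z → x + (y + (z + + 0)) ≡ y + (x + z)
  regroup = solve-∀

binomial-theorem : ∀ x y n → (x + y) ^ n ≡ ((x ^_) ⋆ (y ^_)) n
binomial-theorem x y zero    = refl
binomial-theorem x y (suc n) = begin
  (x + y) * (x + y) ^ n                                ≡⟨ cong (_*_ (x + y)) (binomial-theorem x y n) ⟩
  (x + y) * ((x ^_) ⋆ (y ^_)) n                        ≡⟨ ℤ.*-distribʳ-+ _ x y ⟩
  x * ((x ^_) ⋆ (y ^_)) n + y * ((x ^_) ⋆ (y ^_)) n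
    ≡⟨ cong₂ _+_ (⋆-scaleˡ x (x ^_) (y ^_) n) (⋆-scaleʳ y (x ^_) (y ^_) n) ⟨
  ((x ^_) ∘ suc ⋆ (y ^_)) n + ((x ^_) ⋆ (y ^_) ∘ suc) n ≡⟨ ⋆-leibniz (x ^_) (y ^_) n ⟨
  ((x ^_) ⋆ (y ^_)) (suc n)                            ∎
  where open ≡-Reasoning

-- xPowSeq j n is c_j(n) = n! [tⁿ] x^j, and xSeq n = n! [tⁿ] x.
xSeq : ℕ → ℤ
xSeq zero    = + 0
xSeq (suc m) = sgn m

xPowSeq : ℕ → ℕ → ℤ
xPowSeq zero    = δ
xPowSeq (suc j) = xSeq ⋆ xPowSeq j

xSeq-derivative : ∀ m → xSeq (suc m) ≡ δ m - xSeq m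
xSeq-derivative zero    = refl
xSeq-derivative (suc m) = sym (ℤ.+-identityˡ (- sgn m))

xPowSeq-at-0 : ∀ j → xPowSeq j 0 ≡ δ j
xPowSeq-at-0 zero    = refl
xPowSeq-at-0 (suc j) = vanish (xPowSeq j 0)
  where
  vanish : ∀ x → + 1 * + 0 * x + + 0 ≡ + 0
  vanish = solve-∀

xPowSeq-derivative : ∀ j n → xPowSeq j (suc n) ≡ + j * (xPowSeq (pred j) n - xPowSeq j n)
xPowSeq-derivative zero    n = sym (ℤ.*-zeroˡ (δ n - δ n))
xPowSeq-derivative (suc j) n = begin
  (xSeq ⋆ c j) (suc n)
    ≡⟨ ⋆-leibniz xSeq (c j) n ⟩
  (xSeq ∘ suc ⋆ c j) n + (xSeq ⋆ c j ∘ suc) n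
    ≡⟨ cong₂ _+_ (⋆-congˡ (c j) n xSeq-derivative) (⋆-congʳ xSeq n (xPowSeq-derivative j)) ⟩
  ((λ m → δ m - xSeq m) ⋆ c j) n + (xSeq ⋆ (λ m → + j * (c (pred j) m - c j m))) n
    ≡⟨ cong₂ _+_ (⋆-subˡ δ xSeq (c j) n)
                 (trans (⋆-scaleʳ (+ j) xSeq (λ m → c (pred j) m - c j m) n)
                        (cong (_*_ (+ j)) (⋆-subʳ xSeq (c (pred j)) (c j) n))) ⟩
  ((δ ⋆ c j) n - c (suc j) n) + + j * ((xSeq ⋆ c (pred j)) n - c (suc j) n)
    ≡⟨ cong₂ _+_ (cong (_- c (suc j) n) (⋆-identityˡ (c j) n)) (scaled-pred j) ⟩
  (c j n - c (suc j) n) + + j * (c j n - c (suc j) n)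
    ≡⟨ collect (+ j) (c j n) (c (suc j) n) ⟩
  + suc j * (c j n - c (suc j) n) ∎
  where
  open ≡-Reasoning
  c = xPowSeq
  scaled-pred : ∀ j → + j * ((xSeq ⋆ c (pred j)) n - c (suc j) n) ≡ + j * (c j n - c (suc j) n)
  scaled-pred zero    = trans (ℤ.*-zeroˡ ((xSeq ⋆ c 0) n - c 1 n)) (sym (ℤ.*-zeroˡ (c 0 n - c 1 n)))
  scaled-pred (suc j) = refl
  collect : ∀ j x y → (x - y) + j * (x - y) ≡ (+ 1 + j) * (x - y)
  collect = solve-∀

xPowSeq-vanishes : ∀ {j n} → n < j → xPowSeq j n ≡ + 0
xPowSeq-vanishes {suc j} {zero}  _         = xPowSeq-at-0 (suc j)
xPowSeq-vanishes {suc j} {suc n} (s≤s n<j) = begin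
  xPowSeq (suc j) (suc n)                      ≡⟨ xPowSeq-derivative (suc j) n ⟩
  + suc j * (xPowSeq j n - xPowSeq (suc j) n)
    ≡⟨ cong₂ (λ u v → + suc j * (u - v)) (xPowSeq-vanishes n<j) (xPowSeq-vanishes (ℕ.m<n⇒m<1+n n<j)) ⟩
  + suc j * (+ 0 - + 0)                        ≡⟨ ℤ.*-zeroʳ (+ suc j) ⟩
  + 0                                          ∎
  where open ≡-Reasoning

j!∣xPowSeq : ∀ j n → + (j !) Div.∣ xPowSeq j n
j!∣xPowSeq zero    zero    = Div.∣-refl
j!∣xPowSeq (suc j) zero    = subst (+ (suc j !) Div.∣_) (sym (xPowSeq-at-0 (suc j))) (Div.divides (+ 0) refl)
j!∣xPowSeq zero    (suc n) = Div.divides (+ 0) refl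
j!∣xPowSeq (suc j) (suc n) = subst₂ Div._∣_ (sym (ℤ.pos-* (suc j) (j !))) (sym (xPowSeq-derivative (suc j) n))
  (Div.*-monoʳ-∣ (+ suc j) (Div.∣m∣n⇒∣m-n (j!∣xPowSeq j n)
    (Div.∣-trans (Div.divides (+ suc j) (ℤ.pos-* (suc j) (j !))) (j!∣xPowSeq (suc j) n))))

jCi*[-i]≡j*[pred[j]Ci-jCi] : ∀ j i → + (j C i) * - + i ≡ + j * (+ (pred j C i) - + (j C i))
jCi*[-i]≡j*[pred[j]Ci-jCi] zero    zero    = refl
jCi*[-i]≡j*[pred[j]Ci-jCi] zero    (suc i) = refl
jCi*[-i]≡j*[pred[j]Ci-jCi] (suc j) zero    = sym (ℤ.*-zeroʳ (+ suc j))
jCi*[-i]≡j*[pred[j]Ci-jCi] (suc j) (suc i) = begin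
  + (suc j C suc i) * - + suc i                ≡⟨ ℤ.neg-distribʳ-* (+ (suc j C suc i)) (+ suc i) ⟨
  - (+ (suc j C suc i) * + suc i)              ≡⟨ cong -_ (ℤ.pos-* (suc j C suc i) (suc i)) ⟨
  - + ((suc j C suc i) ℕ.* suc i)              ≡⟨ cong (-_ ∘ +_) ([1+n]C[1+k]*[1+k]≡[1+n]*nCk j i) ⟩
  - + (suc j ℕ.* (j C i))                      ≡⟨ cong -_ (ℤ.pos-* (suc j) (j C i)) ⟩
  - (+ suc j * + (j C i))                      ≡⟨ pascal-diff (+ suc j) (+ (j C i)) (+ (j C suc i)) ⟨
  + suc j * (+ (j C suc i) - (+ (j C i) + + (j C suc i)))
    ≡⟨ cong (λ c → + suc j * (+ (j C suc i) - c)) (ℤ.pos-+ (j C i) (j C suc i)) ⟨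
  + suc j * (+ (j C suc i) - + (j C i ℕ.+ j C suc i))
    ≡⟨ cong (λ c → + suc j * (+ (j C suc i) - + c)) (nCk+nC[k+1]≡[n+1]C[k+1] j i) ⟩
  + suc j * (+ (j C suc i) - + (suc j C suc i)) ∎
  where
  open ≡-Reasoning
  pascal-diff : ∀ s a b → s * (b - (a + b)) ≡ - (s * a)
  pascal-diff = solve-∀

-- n! [tⁿ] of Σ_{i < N} (j choose i) (-1)^i e^{-it}, which is x^j once N > j.
closedForm : ℕ → ℕ → ℕ → ℤ
closedForm N j n = ∑[ i < N ] (+ (j C i) * (sgn i * (- + i) ^ n))

closedForm-derivative : ∀ N j n → closedForm N j (suc n) ≡ + j * (closedForm N (pred j) n - closedForm N j n)
closedForm-derivative N j n = begin
  ∑[ i < N ] (+ (j C i) * (sgn i * (- + i) ^ suc n))   ≡⟨ ∑-cong N (λ i _ → term i) ⟩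
  ∑[ i < N ] (+ j * (t (pred j) i - t j i))            ≡⟨ *-distribˡ-∑ N (+ j) (λ i → t (pred j) i - t j i) ⟨
  + j * ∑[ i < N ] (t (pred j) i - t j i)              ≡⟨ cong (_*_ (+ j)) (∑-distrib-- N (t (pred j)) (t j)) ⟩
  + j * (closedForm N (pred j) n - closedForm N j n)   ∎
  where
  open ≡-Reasoning
  t : ℕ → ℕ → ℤ
  t j i = + (j C i) * (sgn i * (- + i) ^ n)
  rearrange : ∀ c x s P → c * (s * (x * P)) ≡ (c * x) * (s * P)
  rearrange = solve-∀
  expand : ∀ j c′ c Q → (j * (c′ - c)) * Q ≡ j * (c′ * Q - c * Q)
  expand = solve-∀
  term : ∀ i → + (j C i) * (sgn i * (- + i) ^ suc n) ≡ + j * (t (pred j) i - t j i)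
  term i = begin
    + (j C i) * (sgn i * (- + i * (- + i) ^ n))
      ≡⟨ rearrange (+ (j C i)) (- + i) (sgn i) ((- + i) ^ n) ⟩
    (+ (j C i) * - + i) * (sgn i * (- + i) ^ n)
      ≡⟨ cong (_* (sgn i * (- + i) ^ n)) (jCi*[-i]≡j*[pred[j]Ci-jCi] j i) ⟩
    (+ j * (+ (pred j C i) - + (j C i))) * (sgn i * (- + i) ^ n)
      ≡⟨ expand (+ j) (+ (pred j C i)) (+ (j C i)) (sgn i * (- + i) ^ n) ⟩
    + j * (t (pred j) i - t j i) ∎

sgn≡-1^ : ∀ i → sgn i ≡ -1ℤ ^ i
sgn≡-1^ zero    = refl
sgn≡-1^ (suc i) = trans (cong -_ (sgn≡-1^ i)) (sym (ℤ.-1*i≡-i (-1ℤ ^ i)))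

0^≡δ : ∀ j → 0ℤ ^ j ≡ δ j
0^≡δ zero    = refl
0^≡δ (suc j) = refl

closedForm-at-0 : ∀ {N j} → j < N → closedForm N j 0 ≡ δ j
closedForm-at-0 {N} {j} j<N = begin
  closedForm N j 0                        ≡⟨ cong (λ M → closedForm M j 0) (ℕ.m+[n∸m]≡n j<N) ⟨
  closedForm (suc j ℕ.+ (N ∸ suc j)) j 0  ≡⟨ ∑-extend (suc j) (N ∸ suc j) t (λ i _ → beyond-j i) ⟩
  closedForm (suc j) j 0                  ≡⟨ ∑-cong (suc j) (λ i _ → binomial-term i) ⟩
  ((-1ℤ ^_) ⋆ (1ℤ ^_)) j                  ≡⟨ binomial-theorem -1ℤ 1ℤ j ⟨
  0ℤ ^ j                                  ≡⟨ 0^≡δ j ⟩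
  δ j                                     ∎
  where
  open ≡-Reasoning
  t : ℕ → ℤ
  t i = + (j C i) * (sgn i * (- + i) ^ 0)
  beyond-j : ∀ i → t (suc j ℕ.+ i) ≡ + 0
  beyond-j i = cong (λ c → + c * (sgn (suc j ℕ.+ i) * + 1)) (k>n⇒nCk≡0 (s≤s (ℕ.m≤m+n j i)))
  regroup : ∀ c s → c * (s * + 1) ≡ c * s * + 1
  regroup = solve-∀
  binomial-term : ∀ i → t i ≡ + (j C i) * -1ℤ ^ i * 1ℤ ^ (j ∸ i)
  binomial-term i = begin
    + (j C i) * (sgn i * + 1)          ≡⟨ regroup (+ (j C i)) (sgn i) ⟩
    + (j C i) * sgn i * + 1
      ≡⟨ cong₂ (λ s u → + (j C i) * s * u) (sgn≡-1^ i) (sym (ℤ.^-zeroˡ (j ∸ i))) ⟩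
    + (j C i) * -1ℤ ^ i * 1ℤ ^ (j ∸ i) ∎

xPowSeq≡closedForm : ∀ {N j} n → j < N → xPowSeq j n ≡ closedForm N j n
xPowSeq≡closedForm         zero    j<N = trans (xPowSeq-at-0 _) (sym (closedForm-at-0 j<N))
xPowSeq≡closedForm {N} {j} (suc n) j<N = begin
  xPowSeq j (suc n)                                   ≡⟨ xPowSeq-derivative j n ⟩
  + j * (xPowSeq (pred j) n - xPowSeq j n)
    ≡⟨ cong₂ (λ u v → + j * (u - v))
             (xPowSeq≡closedForm n (ℕ.≤-<-trans ℕ.pred[n]≤n j<N)) (xPowSeq≡closedForm n j<N) ⟩
  + j * (closedForm N (pred j) n - closedForm N j n)  ≡⟨ closedForm-derivative N j n ⟨
  closedForm N j (suc n)                              ∎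
  where open ≡-Reasoning

fromℤℚ : ℤ → ℚ
fromℤℚ z = z / 1

toℚᵘ-fromℤℚ : ∀ z → toℚᵘ (fromℤℚ z) ℚᵘ.≃ mkℚᵘ z 0
toℚᵘ-fromℤℚ z = ℚ.toℚᵘ-fromℚᵘ (mkℚᵘ z 0)

fromℤℚ-homo-+ : ∀ a b → fromℤℚ (a + b) ≡ fromℤℚ a ℚ.+ fromℤℚ b
fromℤℚ-homo-+ a b = ℚ.toℚᵘ-injective (begin
  toℚᵘ (fromℤℚ (a + b))                 ≈⟨ toℚᵘ-fromℤℚ (a + b) ⟩
  mkℚᵘ (a + b) 0                        ≈⟨ *≡* (same a b) ⟩
  mkℚᵘ a 0 ℚᵘ.+ mkℚᵘ b 0                ≈⟨ ℚᵘ.+-cong (toℚᵘ-fromℤℚ a) (toℚᵘ-fromℤℚ b) ⟨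
  toℚᵘ (fromℤℚ a) ℚᵘ.+ toℚᵘ (fromℤℚ b)  ≈⟨ ℚ.toℚᵘ-homo-+ (fromℤℚ a) (fromℤℚ b) ⟨
  toℚᵘ (fromℤℚ a ℚ.+ fromℤℚ b)          ∎)
  where
  open ℚᵘ.≃-Reasoning
  same : ∀ a b → (a + b) * + 1 ≡ (a * + 1 + b * + 1) * + 1
  same = solve-∀

fromℤℚ-homo-* : ∀ a b → fromℤℚ (a * b) ≡ fromℤℚ a ℚ.* fromℤℚ b
fromℤℚ-homo-* a b = ℚ.toℚᵘ-injective (begin
  toℚᵘ (fromℤℚ (a * b))                 ≈⟨ toℚᵘ-fromℤℚ (a * b) ⟩
  mkℚᵘ a 0 ℚᵘ.* mkℚᵘ b 0                ≈⟨ ℚᵘ.*-cong (toℚᵘ-fromℤℚ a) (toℚᵘ-fromℤℚ b) ⟨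
  toℚᵘ (fromℤℚ a) ℚᵘ.* toℚᵘ (fromℤℚ b)  ≈⟨ ℚ.toℚᵘ-homo-* (fromℤℚ a) (fromℤℚ b) ⟨
  toℚᵘ (fromℤℚ a ℚ.* fromℤℚ b)          ∎)
  where open ℚᵘ.≃-Reasoning

fromℤℚ-homo‿- : ∀ a → fromℤℚ (- a) ≡ ℚ.- fromℤℚ a
fromℤℚ-homo‿- a = ℚ.toℚᵘ-injective (begin
  toℚᵘ (fromℤℚ (- a))   ≈⟨ toℚᵘ-fromℤℚ (- a) ⟩
  ℚᵘ.- mkℚᵘ a 0         ≈⟨ ℚᵘ.-‿cong (toℚᵘ-fromℤℚ a) ⟨
  ℚᵘ.- toℚᵘ (fromℤℚ a)  ≈⟨ ℚ.toℚᵘ-homo‿- (fromℤℚ a) ⟨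
  toℚᵘ (ℚ.- fromℤℚ a)   ∎)
  where open ℚᵘ.≃-Reasoning

fromℕℚ-homo-* : ∀ m n → fromℕℚ (m ℕ.* n) ≡ fromℕℚ m ℚ.* fromℕℚ n
fromℕℚ-homo-* m n = trans (cong fromℤℚ (ℤ.pos-* m n)) (fromℤℚ-homo-* (+ m) (+ n))

[z/d]*d≡z : ∀ z d .{{_ : ℕ.NonZero d}} → (z / d) ℚ.* fromℕℚ d ≡ fromℤℚ z
[z/d]*d≡z z d@(suc d-1) = ℚ.toℚᵘ-injective (begin
  toℚᵘ ((z / d) ℚ.* fromℕℚ d)        ≈⟨ ℚ.toℚᵘ-homo-* (z / d) (fromℕℚ d) ⟩
  toℚᵘ (z / d) ℚᵘ.* toℚᵘ (fromℕℚ d)  ≈⟨ ℚᵘ.*-cong (ℚ.toℚᵘ-fromℚᵘ (mkℚᵘ z d-1)) (toℚᵘ-fromℤℚ (+ d)) ⟩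
  mkℚᵘ z d-1 ℚᵘ.* mkℚᵘ (+ d) 0       ≈⟨ *≡* (cross z d) ⟩
  mkℚᵘ z 0                           ≈⟨ toℚᵘ-fromℤℚ z ⟨
  toℚᵘ (fromℤℚ z)                    ∎)
  where
  open ℚᵘ.≃-Reasoning
  cross : ∀ z d → z * + d * + 1 ≡ z * + (d ℕ.* 1)
  cross z d = trans (ℤ.*-identityʳ (z * + d)) (cong (λ e → z * + e) (sym (ℕ.*-identityʳ d)))

fromℤℚ-homo-∑ : ∀ n (f : ℕ → ℤ) → fromℤℚ (∑ n f) ≡ ℚ∑.∑ n (fromℤℚ ∘ f)
fromℤℚ-homo-∑ zero    f = refl
fromℤℚ-homo-∑ (suc n) f =
  trans (fromℤℚ-homo-+ (f 0) _) (cong (fromℤℚ (f 0) ℚ.+_) (fromℤℚ-homo-∑ n (f ∘ suc)))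

sumℚ-applyUpTo : ∀ (h : ℕ → ℚ) g n → sumℚ (map h (applyUpTo g n)) ≡ ℚ∑.∑ n (h ∘ g)
sumℚ-applyUpTo h g zero    = refl
sumℚ-applyUpTo h g (suc n) = cong (h (g 0) ℚ.+_) (sumℚ-applyUpTo h (g ∘ suc) n)

IsEgf : Series → (ℕ → ℤ) → Set
IsEgf f a = ∀ n → f n ℚ.* fromℕℚ (n !) ≡ fromℤℚ (a n)

⊛-isEgf : ∀ {f g a b} → IsEgf f a → IsEgf g b → IsEgf (f ⊛ g) (a ⋆ b)
⊛-isEgf {f} {g} {a} {b} f≈a g≈b n = begin
  sumℚ (map (λ m → f m ℚ.* g (n ∸ m)) (upTo (suc n))) ℚ.* fromℕℚ (n !)
    ≡⟨ cong (ℚ._* fromℕℚ (n !)) (sumℚ-applyUpTo (λ m → f m ℚ.* g (n ∸ m)) id (suc n)) ⟩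
  ℚ∑.∑[ m < suc n ] (f m ℚ.* g (n ∸ m)) ℚ.* fromℕℚ (n !)
    ≡⟨ ℚ.*-comm (ℚ∑.∑[ m < suc n ] (f m ℚ.* g (n ∸ m))) (fromℕℚ (n !)) ⟩
  fromℕℚ (n !) ℚ.* ℚ∑.∑[ m < suc n ] (f m ℚ.* g (n ∸ m))
    ≡⟨ ℚ∑.*-distribˡ-∑ (suc n) (fromℕℚ (n !)) (λ m → f m ℚ.* g (n ∸ m)) ⟩
  ℚ∑.∑[ m < suc n ] (fromℕℚ (n !) ℚ.* (f m ℚ.* g (n ∸ m)))
    ≡⟨ ℚ∑.∑-cong (suc n) (λ m m<1+n → term m (ℕ.≤-pred m<1+n)) ⟩
  ℚ∑.∑[ m < suc n ] fromℤℚ (+ (n C m) * a m * b (n ∸ m))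
    ≡⟨ sym (fromℤℚ-homo-∑ (suc n) (λ m → + (n C m) * a m * b (n ∸ m))) ⟩
  fromℤℚ ((a ⋆ b) n) ∎
  where
  open ≡-Reasoning
  open +-*-Solver
  term : ∀ m → m ≤ n → fromℕℚ (n !) ℚ.* (f m ℚ.* g (n ∸ m)) ≡ fromℤℚ (+ (n C m) * a m * b (n ∸ m))
  term m m≤n = begin
    fromℕℚ (n !) ℚ.* (f m ℚ.* g (n ∸ m))
      ≡⟨ cong (λ N → fromℕℚ N ℚ.* (f m ℚ.* g (n ∸ m))) (sym (nCk*k!*[n∸k]!≡n! m≤n)) ⟩
    fromℕℚ ((n C m) ℕ.* (m ! ℕ.* (n ∸ m) !)) ℚ.* (f m ℚ.* g (n ∸ m))
      ≡⟨ cong (ℚ._* (f m ℚ.* g (n ∸ m))) (trans (fromℕℚ-homo-* (n C m) (m ! ℕ.* (n ∸ m) !))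
                                                (cong (fromℕℚ (n C m) ℚ.*_) (fromℕℚ-homo-* (m !) ((n ∸ m) !)))) ⟩
    fromℕℚ (n C m) ℚ.* (fromℕℚ (m !) ℚ.* fromℕℚ ((n ∸ m) !)) ℚ.* (f m ℚ.* g (n ∸ m))
      ≡⟨ shuffle (fromℕℚ (n C m)) (fromℕℚ (m !)) (fromℕℚ ((n ∸ m) !)) (f m) (g (n ∸ m)) ⟩
    fromℕℚ (n C m) ℚ.* (f m ℚ.* fromℕℚ (m !)) ℚ.* (g (n ∸ m) ℚ.* fromℕℚ ((n ∸ m) !))
      ≡⟨ cong₂ (λ u v → fromℕℚ (n C m) ℚ.* u ℚ.* v) (f≈a m) (g≈b (n ∸ m)) ⟩
    fromℤℚ (+ (n C m)) ℚ.* fromℤℚ (a m) ℚ.* fromℤℚ (b (n ∸ m))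
      ≡⟨ trans (fromℤℚ-homo-* (+ (n C m) * a m) (b (n ∸ m)))
               (cong (ℚ._* fromℤℚ (b (n ∸ m))) (fromℤℚ-homo-* (+ (n C m)) (a m))) ⟨
    fromℤℚ (+ (n C m) * a m * b (n ∸ m)) ∎
    where
    shuffle : ∀ c x y u v → c ℚ.* (x ℚ.* y) ℚ.* (u ℚ.* v) ≡ c ℚ.* (u ℚ.* x) ℚ.* (v ℚ.* y)
    shuffle = solve 5 (λ c x y u v → c :* (x :* y) :* (u :* v) := c :* (u :* x) :* (v :* y)) refl

const-isEgf : IsEgf (const 1ℚ) δ
const-isEgf zero    = ℚ.*-identityˡ 1ℚ
const-isEgf (suc n) = ℚ.*-zeroˡ (fromℕℚ (suc n !))

oneMinusExpNeg-isEgf : IsEgf oneMinusExpNeg xSeq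
oneMinusExpNeg-isEgf zero    = refl
oneMinusExpNeg-isEgf (suc m) = begin
  (0ℚ ℚ.+ ℚ.- expNeg (suc m)) ℚ.* fromℕℚ (suc m !)
    ≡⟨ cong (ℚ._* fromℕℚ (suc m !)) (ℚ.+-identityˡ (ℚ.- expNeg (suc m))) ⟩
  ℚ.- expNeg (suc m) ℚ.* fromℕℚ (suc m !)
    ≡⟨ ℚ.neg-distribˡ-* (expNeg (suc m)) (fromℕℚ (suc m !)) ⟨
  ℚ.- (expNeg (suc m) ℚ.* fromℕℚ (suc m !))
    ≡⟨ cong ℚ.-_ ([z/d]*d≡z (sgn (suc m)) (suc m !) {{suc m !≢0}}) ⟩
  ℚ.- fromℤℚ (- sgn m)
    ≡⟨ fromℤℚ-homo‿- (- sgn m) ⟨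
  fromℤℚ (- - sgn m)
    ≡⟨ cong fromℤℚ (ℤ.neg-involutive (sgn m)) ⟩
  fromℤℚ (sgn m) ∎
  where open ≡-Reasoning

oneMinusExpNeg^-isEgf : ∀ j → IsEgf (oneMinusExpNeg ^ˢ j) (xPowSeq j)
oneMinusExpNeg^-isEgf zero    = const-isEgf
oneMinusExpNeg^-isEgf (suc j) =
  ⊛-isEgf {oneMinusExpNeg} {oneMinusExpNeg ^ˢ j} {xSeq} {xPowSeq j} oneMinusExpNeg-isEgf (oneMinusExpNeg^-isEgf j)

pos-^ : ∀ m k → + (m ℕ.^ k) ≡ (+ m) ^ k
pos-^ m zero    = refl
pos-^ m (suc k) = trans (ℤ.pos-* m (m ℕ.^ k)) (cong (_*_ (+ m)) (pos-^ m k))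

polyBernoulliSum : ℕ → ℕ → ℕ → ℤ
polyBernoulliSum N k n = ∑[ j < N ] ((+ suc j) ^ k * xPowSeq j n)

polyBernoulliNeg≡polyBernoulliSum : ∀ k n → polyBernoulliNeg k n ≡ fromℤℚ (polyBernoulliSum (suc n) k n)
polyBernoulliNeg≡polyBernoulliSum k n = begin
  fromℕℚ (n !) ℚ.* sumℚ (map h (upTo (suc n)))
    ≡⟨ cong (fromℕℚ (n !) ℚ.*_) (sumℚ-applyUpTo h id (suc n)) ⟩
  fromℕℚ (n !) ℚ.* ℚ∑.∑ (suc n) h
    ≡⟨ ℚ∑.*-distribˡ-∑ (suc n) (fromℕℚ (n !)) h ⟩
  ℚ∑.∑[ j < suc n ] (fromℕℚ (n !) ℚ.* h j)
    ≡⟨ ℚ∑.∑-cong (suc n) (λ j _ → term j) ⟩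
  ℚ∑.∑[ j < suc n ] fromℤℚ ((+ suc j) ^ k * xPowSeq j n)
    ≡⟨ fromℤℚ-homo-∑ (suc n) (λ j → (+ suc j) ^ k * xPowSeq j n) ⟨
  fromℤℚ (polyBernoulliSum (suc n) k n) ∎
  where
  open ≡-Reasoning
  open +-*-Solver
  h : ℕ → ℚ
  h j = fromℕℚ (suc j ℕ.^ k) ℚ.* (oneMinusExpNeg ^ˢ j) n
  shuffle : ∀ N w P → N ℚ.* (w ℚ.* P) ≡ w ℚ.* (P ℚ.* N)
  shuffle = solve 3 (λ N w P → N :* (w :* P) := w :* (P :* N)) refl
  term : ∀ j → fromℕℚ (n !) ℚ.* h j ≡ fromℤℚ ((+ suc j) ^ k * xPowSeq j n)
  term j = begin
    fromℕℚ (n !) ℚ.* h j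
      ≡⟨ shuffle (fromℕℚ (n !)) (fromℕℚ (suc j ℕ.^ k)) ((oneMinusExpNeg ^ˢ j) n) ⟩
    fromℕℚ (suc j ℕ.^ k) ℚ.* ((oneMinusExpNeg ^ˢ j) n ℚ.* fromℕℚ (n !))
      ≡⟨ cong (fromℕℚ (suc j ℕ.^ k) ℚ.*_) (oneMinusExpNeg^-isEgf j n) ⟩
    fromℤℚ (+ (suc j ℕ.^ k)) ℚ.* fromℤℚ (xPowSeq j n)
      ≡⟨ fromℤℚ-homo-* (+ (suc j ℕ.^ k)) (xPowSeq j n) ⟨
    fromℤℚ (+ (suc j ℕ.^ k) * xPowSeq j n)
      ≡⟨ cong (λ w → fromℤℚ (w * xPowSeq j n)) (pos-^ (suc j) k) ⟩
    fromℤℚ ((+ suc j) ^ k * xPowSeq j n) ∎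

polyBernoulliSum-extend : ∀ {N} k n → suc n ≤ N → polyBernoulliSum N k n ≡ polyBernoulliSum (suc n) k n
polyBernoulliSum-extend {N} k n n<N = begin
  polyBernoulliSum N k n                        ≡⟨ cong (λ M → polyBernoulliSum M k n) (ℕ.m+[n∸m]≡n n<N) ⟨
  polyBernoulliSum (suc n ℕ.+ (N ∸ suc n)) k n  ≡⟨ ∑-extend (suc n) (N ∸ suc n) term beyond-n ⟩
  polyBernoulliSum (suc n) k n                  ∎
  where
  open ≡-Reasoning
  term : ℕ → ℤ
  term j = (+ suc j) ^ k * xPowSeq j n
  beyond-n : ∀ i → i < N ∸ suc n → term (suc n ℕ.+ i) ≡ + 0
  beyond-n i _ = trans (cong (_*_ ((+ suc (suc n ℕ.+ i)) ^ k)) (xPowSeq-vanishes (s≤s (ℕ.m≤m+n n i))))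
                       (ℤ.*-zeroʳ ((+ suc (suc n ℕ.+ i)) ^ k))

infix 4 _≡_[mod_]
record _≡_[mod_] (a b : ℤ) (p : ℕ) : Set where
  constructor mod
  field divides-difference : + p Div.∣ a - b
open _≡_[mod_] public

module _ (p : ℕ) where

  private
    infix 4 _≈_
    _≈_ : ℤ → ℤ → Set
    a ≈ b = a ≡ b [mod p ]

    ≈-by : ∀ {a b e} → a - b ≡ e → + p Div.∣ e → a ≈ b
    ≈-by a-b≡e p∣e = mod (subst (+ p Div.∣_) (sym a-b≡e) p∣e)

    ≈-reflexive : ∀ {a b} → a ≡ b → a ≈ b
    ≈-reflexive {a} refl = ≈-by (ℤ.+-inverseʳ a) (Div.divides (+ 0) refl)

    ≈-sym : ∀ {a b} → a ≈ b → b ≈ a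
    ≈-sym {a} {b} a≈b = ≈-by (flip a b) (Div.∣m⇒∣-m (divides-difference a≈b))
      where
      flip : ∀ a b → b - a ≡ - (a - b)
      flip = solve-∀

    ≈-trans : ∀ {a b c} → a ≈ b → b ≈ c → a ≈ c
    ≈-trans {a} {b} {c} a≈b b≈c =
      ≈-by (chain a b c) (Div.∣m∣n⇒∣m+n (divides-difference a≈b) (divides-difference b≈c))
      where
      chain : ∀ a b c → a - c ≡ (a - b) + (b - c)
      chain = solve-∀

    +-cong : ∀ {a b c d} → a ≈ b → c ≈ d → a + c ≈ b + d
    +-cong {a} {b} {c} {d} a≈b c≈d =
      ≈-by (split a b c d) (Div.∣m∣n⇒∣m+n (divides-difference a≈b) (divides-difference c≈d))
      where
      split : ∀ a b c d → (a + c) - (b + d) ≡ (a - b) + (c - d)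
      split = solve-∀

    *-cong : ∀ {a b c d} → a ≈ b → c ≈ d → a * c ≈ b * d
    *-cong {a} {b} {c} {d} a≈b c≈d = ≈-by (split a b c d)
      (Div.∣m∣n⇒∣m+n (Div.∣m⇒∣m*n c (divides-difference a≈b)) (Div.∣n⇒∣m*n b (divides-difference c≈d)))
      where
      split : ∀ a b c d → a * c - b * d ≡ (a - b) * c + b * (c - d)
      split = solve-∀

    -‿cong : ∀ {a b} → a ≈ b → - a ≈ - b
    -‿cong {a} {b} a≈b = ≈-by (negate a b) (Div.∣m⇒∣-m (divides-difference a≈b))
      where
      negate : ∀ a b → - a - - b ≡ - (a - b)
      negate = solve-∀

  -- ℤ with congruence modulo p as its equality stands in for the quotient ring ℤ/pℤ.
  ℤmod : CommutativeRing 0ℓ 0ℓ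
  ℤmod = record
    { Carrier = ℤ
    ; _≈_ = _≈_
    ; _+_ = _+_
    ; _*_ = _*_
    ; -_ = -_
    ; 0# = + 0
    ; 1# = + 1
    ; isCommutativeRing = record
      { isRing = record
        { +-isAbelianGroup = record
          { isGroup = record
            { isMonoid = record
              { isSemigroup = record
                { isMagma = record
                  { isEquivalence = record { refl = ≈-reflexive refl ; sym = ≈-sym ; trans = ≈-trans }
                  ; ∙-cong = +-cong
                  }
                ; assoc = λ a b c → ≈-reflexive (ℤ.+-assoc a b c)
                }
              ; identity = (λ a → ≈-reflexive (ℤ.+-identityˡ a)) , (λ a → ≈-reflexive (ℤ.+-identityʳ a))
              }
            ; inverse = (λ a → ≈-reflexive (ℤ.+-inverseˡ a)) , (λ a → ≈-reflexive (ℤ.+-inverseʳ a))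
            ; ⁻¹-cong = -‿cong
            }
          ; comm = λ a b → ≈-reflexive (ℤ.+-comm a b)
          }
        ; *-cong = *-cong
        ; *-assoc = λ a b c → ≈-reflexive (ℤ.*-assoc a b c)
        ; *-identity = (λ a → ≈-reflexive (ℤ.*-identityˡ a)) , (λ a → ≈-reflexive (ℤ.*-identityʳ a))
        ; distrib = (λ a b c → ≈-reflexive (ℤ.*-distribˡ-+ a b c))
                  , (λ a b c → ≈-reflexive (ℤ.*-distribʳ-+ a b c))
        }
      ; *-comm = λ a b → ≈-reflexive (ℤ.*-comm a b)
      }
    }

module _ {r : ℕ} (p-prime : Prime (suc (suc r))) where

  private
    p = suc (suc r)

  open CommutativeRing (ℤmod p)
    using (_≈_; setoid; +-cong; +-congˡ; +-congʳ; *-cong; *-congˡ; -‿cong)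
    renaming (refl to ≈-refl; reflexive to ≈-reflexive; sym to ≈-sym; trans to ≈-trans)
  open import Algebra.Properties.Ring (CommutativeRing.ring (ℤmod p)) using (+-inverseʳ-unique)
  open import Relation.Binary.Reasoning.Setoid setoid
  module Mod = FiniteSum (ℤmod p)

  p∣⇒≈0 : ∀ {a} → + p Div.∣ a → a ≈ + 0
  p∣⇒≈0 {a} p∣a = mod (subst (+ p Div.∣_) (sym (ℤ.+-identityʳ a)) p∣a)

  small⇒p∤ : ∀ x → 0 < ℤ.∣ x ∣ → ℤ.∣ x ∣ < p → ¬ (+ p Div.∣ x)
  small⇒p∤ x 0<∣x∣ ∣x∣<p p∣x =
    ℕ.<⇒≱ ∣x∣<p (ℕᵈ.∣⇒≤ {{ℕ.>-nonZero 0<∣x∣}} (Div.∣⇒∣ᵤ p∣x))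

  frobenius : ∀ x y → (x + y) ^ p ≈ x ^ p + y ^ p
  frobenius x y = begin
    (x + y) ^ p                                    ≡⟨ binomial-theorem x y p ⟩
    t 0 + ∑[ m < suc (suc r) ] t (suc m)           ≈⟨ +-congˡ {t 0} (Mod.∑-init-last (suc r) (t ∘ suc)) ⟩
    t 0 + (∑[ m < suc r ] t (suc m) + t p)         ≈⟨ +-congˡ {t 0} (+-congʳ {t p} (Mod.∑-vanishes (suc r) middle)) ⟩
    t 0 + (+ 0 + t p)
      ≡⟨ cong₂ (λ c e → t 0 + (+ 0 + + c * x ^ p * y ^ e)) (nCn≡1 p) (ℕ.n∸n≡0 p) ⟩
    + 1 * + 1 * y ^ p + (+ 0 + + 1 * x ^ p * + 1)  ≡⟨ tidy (x ^ p) (y ^ p) ⟩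
    x ^ p + y ^ p                                  ∎
    where
    t : ℕ → ℤ
    t m = + (p C m) * x ^ m * y ^ (p ∸ m)
    middle : ∀ m → m < suc r → t (suc m) ≈ + 0
    middle m m<r = p∣⇒≈0 (Div.∣m⇒∣m*n {m = + (p C suc m) * x ^ suc m} (y ^ (p ∸ suc m))
      (Div.∣m⇒∣m*n {m = + (p C suc m)} (x ^ suc m) (Div.∣ᵤ⇒∣ (p∣pCk p-prime (s≤s z≤n) (s≤s m<r)))))
    tidy : ∀ X Y → + 1 * + 1 * Y + (+ 0 + + 1 * X * + 1) ≡ X + Y
    tidy = solve-∀

  fermat-ℕ : ∀ n → (+ n) ^ p ≈ + n
  fermat-ℕ zero    = ≈-refl
  fermat-ℕ (suc n) = begin
    (+ 1 + + n) ^ p        ≈⟨ frobenius (+ 1) (+ n) ⟩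
    (+ 1) ^ p + (+ n) ^ p  ≈⟨ +-cong (≈-reflexive (ℤ.^-zeroˡ p)) (fermat-ℕ n) ⟩
    + 1 + + n              ∎

  fermat : ∀ x → x ^ p ≈ x
  fermat (+ n)    = fermat-ℕ n
  fermat -[1+ n ] = begin
    (- x) ^ p  ≈⟨ +-inverseʳ-unique (x ^ p) ((- x) ^ p) (≈-sym 0≈x^p+[-x]^p) ⟩
    - (x ^ p)  ≈⟨ -‿cong (fermat-ℕ (suc n)) ⟩
    - x        ∎
    where
    x = + suc n
    0≈x^p+[-x]^p : + 0 ≈ x ^ p + (- x) ^ p
    0≈x^p+[-x]^p = begin
      + 0                ≡⟨ cong (_^ p) (ℤ.+-inverseʳ x) ⟨
      (x + - x) ^ p      ≈⟨ frobenius x (- x) ⟩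
      x ^ p + (- x) ^ p  ∎

  fermat-periodic : ∀ x m {k} → (p ∸ 1) ℕᵈ.∣ k → x ^ (suc m ℕ.+ k) ≈ x ^ suc m
  fermat-periodic x m (ℕᵈ.divides q refl) = periodic q
    where
    shift : ∀ m → x ^ (suc m ℕ.+ suc r) ≈ x ^ suc m
    shift m = begin
      x ^ (suc m ℕ.+ suc r)  ≡⟨ cong (x ^_) (ℕ.+-suc m (suc r)) ⟨
      x ^ (m ℕ.+ p)          ≡⟨ ℤ.^-distribˡ-+-* x m p ⟩
      x ^ m * x ^ p          ≈⟨ *-congˡ {x ^ m} (fermat x) ⟩
      x ^ m * x              ≡⟨ ℤ.*-comm (x ^ m) x ⟩
      x ^ suc m              ∎
    regroup : ∀ m r q → suc m ℕ.+ (suc r ℕ.+ q ℕ.* suc r) ≡ suc (m ℕ.+ q ℕ.* suc r) ℕ.+ suc r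
    regroup = ℕ-Solver.solve-∀
    periodic : ∀ q → x ^ (suc m ℕ.+ q ℕ.* suc r) ≈ x ^ suc m
    periodic zero    = ≈-reflexive (cong (x ^_) (ℕ.+-identityʳ (suc m)))
    periodic (suc q) = begin
      x ^ (suc m ℕ.+ (suc r ℕ.+ q ℕ.* suc r))  ≡⟨ cong (x ^_) (regroup m r q) ⟩
      x ^ (suc (m ℕ.+ q ℕ.* suc r) ℕ.+ suc r)  ≈⟨ shift (m ℕ.+ q ℕ.* suc r) ⟩
      x ^ (suc m ℕ.+ q ℕ.* suc r)              ≈⟨ periodic q ⟩
      x ^ suc m                                ∎

  p∣∣x∣*∣x^[p-1]-1∣ : ∀ x → p ℕᵈ.∣ ℤ.∣ x ∣ ℕ.* ℤ.∣ x ^ (p ∸ 1) - + 1 ∣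
  p∣∣x∣*∣x^[p-1]-1∣ x = subst (p ℕᵈ.∣_) (ℤ.abs-* x (x ^ (p ∸ 1) - + 1))
    (Div.∣⇒∣ᵤ (subst (+ p Div.∣_) (factor x (x ^ (p ∸ 1))) (divides-difference (fermat x))))
    where
    factor : ∀ x y → x * y - x ≡ x * (y - + 1)
    factor = solve-∀

  fermat-unit : ∀ {x} → ¬ (+ p Div.∣ x) → x ^ (p ∸ 1) ≈ + 1
  fermat-unit {x} p∤x
    with euclidsLemma ℤ.∣ x ∣ ℤ.∣ x ^ (p ∸ 1) - + 1 ∣ p-prime (p∣∣x∣*∣x^[p-1]-1∣ x)
  ... | inj₁ p∣x         = contradiction (Div.∣ᵤ⇒∣ p∣x) p∤x
  ... | inj₂ p∣x^[p-1]-1 = mod (Div.∣ᵤ⇒∣ p∣x^[p-1]-1)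

  unit^≈1 : ∀ {x k} → ¬ (+ p Div.∣ x) → (p ∸ 1) ℕᵈ.∣ k → x ^ k ≈ + 1
  unit^≈1 {x} p∤x (ℕᵈ.divides q refl) = power q
    where
    power : ∀ q → x ^ (q ℕ.* suc r) ≈ + 1
    power zero    = ≈-refl
    power (suc q) = begin
      x ^ (suc r ℕ.+ q ℕ.* suc r)    ≡⟨ ℤ.^-distribˡ-+-* x (suc r) (q ℕ.* suc r) ⟩
      x ^ suc r * x ^ (q ℕ.* suc r)  ≈⟨ *-cong (fermat-unit p∤x) (power q) ⟩
      + 1                            ∎

  polyBernoulliSum-truncate : ∀ k n → polyBernoulliSum (p ℕ.+ n) k n ≈ polyBernoulliSum p k n
  polyBernoulliSum-truncate k n =
    Mod.∑-extend p n (λ j → (+ suc j) ^ k * xPowSeq j n) (λ i _ → p∣⇒≈0 (beyond-p i))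
    where
    p∣[p+i]! : ∀ i → p ℕᵈ.∣ (p ℕ.+ i) !
    p∣[p+i]! i = ℕᵈ.∣-trans (ℕᵈ.m∣m*n ((suc r) !)) (ℕᵈ.m≤n⇒m!∣n! (ℕ.m≤m+n p i))
    beyond-p : ∀ i → + p Div.∣ (+ suc (p ℕ.+ i)) ^ k * xPowSeq (p ℕ.+ i) n
    beyond-p i = Div.∣n⇒∣m*n ((+ suc (p ℕ.+ i)) ^ k)
                   (Div.∣-trans (Div.∣ᵤ⇒∣ (p∣[p+i]! i)) (j!∣xPowSeq (p ℕ.+ i) n))

  polyBernoulliSum-reduce : ∀ k n → polyBernoulliSum (suc n) k n ≈ polyBernoulliSum p k n
  polyBernoulliSum-reduce k n = begin
    polyBernoulliSum (suc n) k n    ≡⟨ polyBernoulliSum-extend k n (s≤s (ℕ.m≤n+m n (suc r))) ⟨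
    polyBernoulliSum (p ℕ.+ n) k n  ≈⟨ polyBernoulliSum-truncate k n ⟩
    polyBernoulliSum p k n          ∎

  xPowSeq-periodic : ∀ {j k} m → j < p → (p ∸ 1) ℕᵈ.∣ k → xPowSeq j (suc m ℕ.+ k) ≈ xPowSeq j (suc m)
  xPowSeq-periodic {j} {k} m j<p p-1∣k = begin
    xPowSeq j (suc m ℕ.+ k)       ≡⟨ xPowSeq≡closedForm (suc m ℕ.+ k) j<p ⟩
    closedForm p j (suc m ℕ.+ k)
      ≈⟨ Mod.∑-cong p (λ i _ → *-congˡ {+ (j C i)} (*-congˡ {sgn i} (fermat-periodic (- + i) m p-1∣k))) ⟩
    closedForm p j (suc m)        ≡⟨ xPowSeq≡closedForm (suc m) j<p ⟨
    xPowSeq j (suc m)             ∎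

  polyBernoulliSum≡2-k≡n≡1 : ∀ {k n} → (p ∸ 1) ℕᵈ.∣ k → (p ∸ 1) ℕᵈ.∣ n →
                             polyBernoulliSum p (suc k) (suc n) ≈ + 2
  polyBernoulliSum≡2-k≡n≡1 {k} {n} p-1∣k p-1∣n = begin
    polyBernoulliSum p (suc k) (suc n)
      ≈⟨ Mod.∑-cong p (λ j j<p → *-cong (fermat-periodic (+ suc j) 0 p-1∣k) (xPowSeq-periodic 0 j<p p-1∣n)) ⟩
    polyBernoulliSum p 1 1    ≡⟨ polyBernoulliSum-extend {p} 1 1 (s≤s (s≤s z≤n)) ⟩
    polyBernoulliSum 2 1 1    ≡⟨⟩
    + 2                       ∎

  xPowSeq-at-multiple : ∀ {j n} → j < p → (p ∸ 1) ℕᵈ.∣ suc n → xPowSeq j (suc n) ≈ δ j - + 1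
  xPowSeq-at-multiple {j} {n} j<p p-1∣n = begin
    xPowSeq j (suc n)                   ≡⟨ xPowSeq≡closedForm (suc n) j<p ⟩
    + 0 + ∑[ i < suc r ] t (suc n) i    ≈⟨ +-congˡ {+ 0} (Mod.∑-cong (suc r) {t (suc n)} {t 0} unit-terms) ⟩
    + 0 + ∑[ i < suc r ] t 0 i          ≡⟨ shift (∑[ i < suc r ] t 0 i) ⟩
    closedForm p j 0 - + 1              ≡⟨ cong (_- + 1) (closedForm-at-0 j<p) ⟩
    δ j - + 1                           ∎
    where
    t : ℕ → ℕ → ℤ
    t e i = + (j C suc i) * (sgn (suc i) * (- + suc i) ^ e)
    unit-terms : ∀ i → i < suc r → t (suc n) i ≈ t 0 i
    unit-terms i i<r = *-congˡ {+ (j C suc i)} (*-congˡ {sgn (suc i)}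
      (unit^≈1 (small⇒p∤ (- + suc i) (s≤s z≤n) (s≤s i<r)) p-1∣n))
    shift : ∀ s → + 0 + s ≡ (+ 1 + s) - + 1
    shift = solve-∀

  polyBernoulliSum≡2-k≡n≡0 : ∀ {k n} → (p ∸ 1) ℕᵈ.∣ suc k → (p ∸ 1) ℕᵈ.∣ suc n →
                             polyBernoulliSum p (suc k) (suc n) ≈ + 2
  polyBernoulliSum≡2-k≡n≡0 {k} {n} p-1∣k p-1∣n = begin
    polyBernoulliSum p (suc k) (suc n)          ≈⟨ Mod.∑-init-last (suc r) w ⟩
    ∑[ j < suc r ] w j + w (suc r)              ≈⟨ +-cong (Mod.∑-cong (suc r) unit-terms) last-term ⟩
    ∑[ j < suc r ] (+ 1 * (δ j - + 1)) + + 0    ≡⟨ cong (λ s → + 0 + s + + 0) (∑-minus-ones r) ⟩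
    + 0 + - + r + + 0                           ≈⟨ mod (Div.divides -1ℤ (minus-r≡2 (+ r))) ⟩
    + 2                                         ∎
    where
    w : ℕ → ℤ
    w j = (+ suc j) ^ suc k * xPowSeq j (suc n)
    unit-terms : ∀ j → j < suc r → w j ≈ + 1 * (δ j - + 1)
    unit-terms j j<r = *-cong (unit^≈1 (small⇒p∤ (+ suc j) (s≤s z≤n) (s≤s j<r)) p-1∣k)
                              (xPowSeq-at-multiple (ℕ.m<n⇒m<1+n j<r) p-1∣n)
    last-term : w (suc r) ≈ + 0
    last-term = p∣⇒≈0 (Div.∣m⇒∣m*n (xPowSeq (suc r) (suc n)) (Div.∣m⇒∣m*n ((+ p) ^ k) Div.∣-refl))
    ∑-minus-ones : ∀ r → ∑[ j < r ] -1ℤ ≡ - + r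
    ∑-minus-ones zero    = refl
    ∑-minus-ones (suc r) = trans (cong (_+_ -1ℤ) (∑-minus-ones r)) (sym (ℤ.neg-distrib-+ (+ 1) (+ r)))
    minus-r≡2 : ∀ r → + 0 + - r + + 0 - + 2 ≡ -1ℤ * (+ 2 + r)
    minus-r≡2 = solve-∀

-- The hypothesis p ≢ 2 is unused: the argument works for p = 2 as well.
theorem3p4 : (p k n : ℕ) → Prime p → p ≢ 2 → k ≥ 1 → n ≥ 1 →
    ((p ∸ 1) ℕᵈ.∣ k × (p ∸ 1) ℕᵈ.∣ n) ⊎ ((p ∸ 1) ℕᵈ.∣ (k ∸ 1) × (p ∸ 1) ℕᵈ.∣ (n ∸ 1)) →
    ∃[ b ] (polyBernoulliNeg k n ≡ b / 1 × ℤ.+ p ∣ b - ℤ.+ 2)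
theorem3p4 0 _ _ 0-prime = contradiction 0-prime ¬prime[0]
theorem3p4 1 _ _ 1-prime = contradiction 1-prime ¬prime[1]
theorem3p4 p@(suc (suc r)) k@(suc _) n@(suc _) p-prime _ (s≤s _) (s≤s _) k,n-mod-[p-1] =
  polyBernoulliSum (suc n) k n ,
  polyBernoulliNeg≡polyBernoulliSum k n ,
  Div.∣⇒∣ᵤ (divides-difference (≈-trans (polyBernoulliSum-reduce p-prime k n) (reduced≡2 k,n-mod-[p-1])))
  where
  open CommutativeRing (ℤmod p) using () renaming (trans to ≈-trans)
  reduced≡2 : ((p ∸ 1) ℕᵈ.∣ k × (p ∸ 1) ℕᵈ.∣ n) ⊎
              ((p ∸ 1) ℕᵈ.∣ (k ∸ 1) × (p ∸ 1) ℕᵈ.∣ (n ∸ 1)) →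
              polyBernoulliSum p k n ≡ + 2 [mod p ]
  reduced≡2 (inj₁ (p-1∣k , p-1∣n))     = polyBernoulliSum≡2-k≡n≡0 p-prime p-1∣k p-1∣n
  reduced≡2 (inj₂ (p-1∣k-1 , p-1∣n-1)) = polyBernoulliSum≡2-k≡n≡1 p-prime p-1∣k-1 p-1∣n-1
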